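{- If $\pi\in\operatorname{Av}_n(32\overline{4}1)$ has tail length $\ell$, then $\pi\in s^\ell(\operatorname{Av}_n(32\overline{4}1))$, i.e. there exists $\sigma\in\operatorname{Av}_n(32\overline{4}1)$ with $s^\ell(\sigma)=\pi$.
   Context: $S_n$ is the set of permutations of $\{1,\ldots,n\}$ in one-line notation. West's stack-sorting map $s$ is defined recursively: $s$ sends the empty permutation to itself, and for a nonempty permutation $\pi=LmR$ with $m$ its largest entry, $s(\pi)=s(L)\,s(R)\,m$; $s^t$ is the $t$-fold iterate. A permutation $\pi=\pi_1\cdots\pi_n$ contains the barred pattern $32\overline{4}1$ if there are indices $i_1<i_2<i_3$ with $\pi_{i_1}>\pi_{i_2}>\pi_{i_3}$ and $\pi_j<\pi_{i_1}$ for all $i_2<j<i_3$; otherwise it avoids it. $\operatorname{Av}_n(32\overline{4}1)$ is the set of permutations in $S_n$ avoiding $32\overline{4}1$. The tail length of $\pi\in S_n$ is the largest $\ell\in\{0,\ldots,n\}$ such that $\pi_i=i$ for all $i\in\{n-\ell+1,\ldots,n\}$. -}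

module Defs where

open import Data.Nat using (ℕ; zero; suc; _<_; _⊔_)
open import Data.List using (List; []; _∷_; _++_; length; foldr; lookup; upTo; map)
open import Data.List.Relation.Binary.Permutation.Propositional using (_↭_)
open import Data.Fin using (Fin; toℕ)
open import Data.Product using (_×_; Σ; ∃-syntax)
open import Relation.Nullary using (¬_)
open import Relation.Binary.PropositionalEquality using (_≡_)

oneToN : ℕ → List ℕ
oneToN n = map suc (upTo n)

IsPerm : ℕ → List ℕ → Set
IsPerm n π = π ↭ oneToN n

-- largest entry of a list (0 for the empty list; entries are ≥ 1)
maxL : List ℕ → ℕ
maxL = foldr _⊔_ 0

splitAt : ℕ → List ℕ → List ℕ × List ℕ
splitAt m [] = [] Data.Product., []
splitAt m (x ∷ xs) with Data.Nat._≟_ x m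
... | Relation.Nullary.yes _ = [] Data.Product., xs
... | Relation.Nullary.no _ =
  let r = splitAt m xs in (x ∷ Data.Product.proj₁ r) Data.Product., Data.Product.proj₂ r

-- West's stack-sorting map  s(LmR) = s(L) s(R) m,  with a fuel parameter
-- (fuel ≥ length suffices, since L and R are strictly shorter).
sFuel : ℕ → List ℕ → List ℕ
sFuel zero xs = xs
sFuel (suc k) [] = []
sFuel (suc k) (x ∷ xs) =
  let m = maxL (x ∷ xs)
      lr = splitAt m (x ∷ xs)
  in sFuel k (Data.Product.proj₁ lr) ++ sFuel k (Data.Product.proj₂ lr) ++ (m ∷ [])

stackSort : List ℕ → List ℕ
stackSort π = sFuel (length π) π

stackSortIter : ℕ → List ℕ → List ℕ
stackSortIter zero π = π
stackSortIter (suc t) π = stackSortIter t (stackSort π)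

Contains32b41 : List ℕ → Set
Contains32b41 π =
  ∃[ i₁ ] ∃[ i₂ ] ∃[ i₃ ]
    (toℕ i₁ < toℕ i₂ × toℕ i₂ < toℕ i₃ ×
     lookup π i₂ < lookup π i₁ × lookup π i₃ < lookup π i₂ ×
     ((j : Fin (length π)) → toℕ i₂ < toℕ j → toℕ j < toℕ i₃ →
        lookup π j < lookup π i₁))

Avoids32b41 : List ℕ → Set
Avoids32b41 π = ¬ Contains32b41 π

InAv : ℕ → List ℕ → Set
InAv n π = IsPerm n π × Avoids32b41 π

-- tail length: largest ℓ ≤ n with π_i = i for all n-ℓ+1 ≤ i ≤ n (1-indexed).
-- Positions are 0-indexed: position p holds value p+1.
FixedSuffix : ℕ → List ℕ → ℕ → Set
FixedSuffix n π ℓ = (p : Fin (length π)) → Data.Nat._+_ (toℕ p) ℓ Data.Nat.≥ n → lookup π p ≡ suc (toℕ p)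

TailLength : ℕ → List ℕ → ℕ → Set
TailLength n π ℓ = ℓ Data.Nat.≤ n × FixedSuffix n π ℓ ×
  ((ℓ' : ℕ) → ℓ' Data.Nat.≤ n → FixedSuffix n π ℓ' → ℓ' Data.Nat.≤ ℓ)

-- A permutation avoids 32‾41 exactly when each of its descent tops is a
-- left-to-right maximum, i.e. when it factors as π = m₁C₁ m₂C₂ ⋯ mₖCₖ with
-- m₁ < ⋯ < mₖ its left-to-right maxima and each Cᵢ an increasing run of
-- entries below mᵢ. Stack-sorting such a permutation gives C₁m₁ C₂m₂ ⋯ Cₖmₖ.
-- So if Cₖ is empty, σ = m₁ m₂C₁ m₃C₂ ⋯ mₖCₖ₋₁, obtained by shifting every run
-- one block to the right, again has this shape and s(σ) = π. A tail of length
-- ℓ forces the last ℓ runs to be empty and each shift uses up one of them, so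
-- the shift can be applied ℓ times.
module Submission where

open import Defs
open import Data.Nat using (ℕ; zero; suc; _<_; _≤_; _≥_; _⊔_; _+_; z≤n; s≤s; _<?_)
open import Data.Nat.Properties
open import Data.Fin using (Fin; toℕ; zero; suc)
open import Data.Fin.Properties using (toℕ-injective)
open import Data.List using (List; []; _∷_; _++_; [_]; _∷ʳ_; length; lookup; foldl; map; upTo)
open import Data.List.Properties using (length-++; ++-assoc; ++-identityʳ; length-map; length-upTo)
open import Data.List.Reverse using (Reverse; []; _∶_∶ʳ_; reverseView)
open import Data.List.Membership.Propositional using (_∈_)
open import Data.List.Membership.Propositional.Properties using (∈-map⁻; ∈-upTo⁻)
open import Data.List.Relation.Unary.Any using (here; there)
open import Data.List.Relation.Unary.All as All using (All; []; _∷_)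
import Data.List.Relation.Unary.All.Properties as AllP
open import Data.List.Relation.Unary.AllPairs using (AllPairs; []; _∷_)
import Data.List.Relation.Unary.AllPairs.Properties as AllPairsP
open import Data.List.Relation.Unary.Unique.Propositional using (Unique)
open import Data.List.Relation.Unary.Unique.Propositional.Properties using (upTo⁺)
import Data.List.Relation.Unary.Unique.Propositional.Properties as UniqueP
open import Data.List.Relation.Binary.Permutation.Propositional using (_↭_; ↭-refl; ↭-sym; ↭-trans; ↭⇒↭ₛ)
open import Data.List.Relation.Binary.Permutation.Propositional.Properties using (++⁺; ++⁺ˡ; ∷↭∷ʳ; ∈-resp-↭; ↭-length)
import Data.List.Relation.Binary.Permutation.Setoid.Properties as PermutationS
open import Data.Product using (_×_; _,_; proj₁; proj₂; ∃-syntax)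
open import Data.Sum using (inj₁; inj₂)
open import Data.Unit using (⊤; tt)
open import Data.Empty using (⊥-elim)
open import Relation.Nullary using (yes; no)
open import Relation.Binary using (tri<; tri≈; tri>)
open import Relation.Binary.PropositionalEquality hiding ([_])
open import Relation.Binary.PropositionalEquality.Properties using (setoid)

maxL-∈ : ∀ x xs → maxL (x ∷ xs) ∈ x ∷ xs
maxL-∈ x [] = here (⊔-identityʳ x)
maxL-∈ x (y ∷ ys) with ⊔-sel x (maxL (y ∷ ys))
... | inj₁ eq = here eq
... | inj₂ eq = there (subst (_∈ y ∷ ys) (sym eq) (maxL-∈ y ys))

maxL-≤ : ∀ {m} xs → All (_≤ m) xs → maxL xs ≤ m
maxL-≤ [] [] = z≤n
maxL-≤ (x ∷ xs) (x≤m ∷ xs≤m) = ⊔-lub x≤m (maxL-≤ xs xs≤m)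

maxL-++-∷ : ∀ L m R → All (_< m) L → All (_< m) R → maxL (L ++ m ∷ R) ≡ m
maxL-++-∷ [] m R _ R<m = m≥n⇒m⊔n≡m (maxL-≤ R (All.map <⇒≤ R<m))
maxL-++-∷ (l ∷ L) m R (l<m ∷ L<m) R<m
  rewrite maxL-++-∷ L m R L<m R<m = m≤n⇒m⊔n≡n (<⇒≤ l<m)

splitAt-++-∷ : ∀ m ys → m ∈ ys → proj₁ (splitAt m ys) ++ m ∷ proj₂ (splitAt m ys) ≡ ys
splitAt-++-∷ m (x ∷ xs) m∈ with x Data.Nat.≟ m | m∈
... | yes x≡m | _ = cong (_∷ xs) (sym x≡m)
... | no x≢m | here m≡x = ⊥-elim (x≢m (sym m≡x))
... | no _ | there m∈xs = cong (x ∷_) (splitAt-++-∷ m xs m∈xs)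

splitAt-first : ∀ m L R → All (_< m) L → splitAt m (L ++ m ∷ R) ≡ (L , R)
splitAt-first m [] R [] with m Data.Nat.≟ m
... | yes _ = refl
... | no m≢m = ⊥-elim (m≢m refl)
splitAt-first m (l ∷ L) R (l<m ∷ L<m) with l Data.Nat.≟ m
... | yes l≡m = ⊥-elim (<-irrefl l≡m l<m)
... | no _ rewrite splitAt-first m L R L<m = refl

sFuel-[] : ∀ k → sFuel k [] ≡ []
sFuel-[] zero = refl
sFuel-[] (suc k) = refl

length-splitAt-max : ∀ x xs → let (L , R) = splitAt (maxL (x ∷ xs)) (x ∷ xs) in
  length L + length R ≡ length xs
length-splitAt-max x xs = suc-injective (begin
  suc (length L + length R)   ≡⟨ +-suc (length L) (length R) ⟨
  length L + length (m ∷ R)   ≡⟨ length-++ L ⟨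
  length (L ++ m ∷ R)         ≡⟨ cong length (splitAt-++-∷ m (x ∷ xs) (maxL-∈ x xs)) ⟩
  suc (length xs)             ∎)
  where
  open ≡-Reasoning
  m = maxL (x ∷ xs)
  L = proj₁ (splitAt m (x ∷ xs))
  R = proj₂ (splitAt m (x ∷ xs))

sFuel-fuel-irrelevant : ∀ k k′ xs → length xs ≤ k → length xs ≤ k′ → sFuel k xs ≡ sFuel k′ xs
sFuel-fuel-irrelevant zero k′ [] _ _ = sym (sFuel-[] k′)
sFuel-fuel-irrelevant (suc k) zero [] _ _ = refl
sFuel-fuel-irrelevant (suc k) (suc k′) [] _ _ = refl
sFuel-fuel-irrelevant (suc k) (suc k′) (x ∷ xs) (s≤s xs≤k) (s≤s xs≤k′) =
  cong₂ _++_ (sFuel-fuel-irrelevant k k′ L (≤-trans L≤ xs≤k) (≤-trans L≤ xs≤k′))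
    (cong (_++ _) (sFuel-fuel-irrelevant k k′ R (≤-trans R≤ xs≤k) (≤-trans R≤ xs≤k′)))
  where
  L = proj₁ (splitAt (maxL (x ∷ xs)) (x ∷ xs))
  R = proj₂ (splitAt (maxL (x ∷ xs)) (x ∷ xs))
  L≤ : length L ≤ length xs
  L≤ = m+n≤o⇒m≤o (length L) (≤-reflexive (length-splitAt-max x xs))
  R≤ : length R ≤ length xs
  R≤ = m+n≤o⇒n≤o (length L) (≤-reflexive (length-splitAt-max x xs))

sFuel-suc : ∀ k ys → ys ≢ [] → let (L , R) = splitAt (maxL ys) ys in
  sFuel (suc k) ys ≡ sFuel k L ++ sFuel k R ++ [ maxL ys ]
sFuel-suc k [] ys≢[] = ⊥-elim (ys≢[] refl)
sFuel-suc k (y ∷ ys) _ = refl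

++-∷-≢[] : ∀ (L : List ℕ) m R → L ++ m ∷ R ≢ []
++-∷-≢[] [] m R ()
++-∷-≢[] (l ∷ L) m R ()

stackSort-++-∷ : ∀ L m R → All (_< m) L → All (_< m) R →
  stackSort (L ++ m ∷ R) ≡ stackSort L ++ stackSort R ++ [ m ]
stackSort-++-∷ L m R L<m R<m = begin
  sFuel (length ys) ys
    ≡⟨ cong (λ k → sFuel k ys) (trans (length-++ L) (+-suc (length L) (length R))) ⟩
  sFuel (suc k) ys
    ≡⟨ sFuel-suc k ys (++-∷-≢[] L m R) ⟩
  sFuel k (proj₁ (splitAt (maxL ys) ys)) ++ sFuel k (proj₂ (splitAt (maxL ys) ys)) ++ [ maxL ys ]
    ≡⟨ cong (λ q → sFuel k (proj₁ (splitAt q ys)) ++ sFuel k (proj₂ (splitAt q ys)) ++ [ q ])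
         (maxL-++-∷ L m R L<m R<m) ⟩
  sFuel k (proj₁ (splitAt m ys)) ++ sFuel k (proj₂ (splitAt m ys)) ++ [ m ]
    ≡⟨ cong (λ (L′ , R′) → sFuel k L′ ++ sFuel k R′ ++ [ m ]) (splitAt-first m L R L<m) ⟩
  sFuel k L ++ sFuel k R ++ [ m ]
    ≡⟨ cong₂ _++_ (sFuel-fuel-irrelevant k (length L) L (m≤m+n _ _) ≤-refl)
         (cong (_++ [ m ]) (sFuel-fuel-irrelevant k (length R) R (m≤n+m _ _) ≤-refl)) ⟩
  stackSort L ++ stackSort R ++ [ m ]
    ∎
  where
  open ≡-Reasoning
  ys = L ++ m ∷ R
  k = length L + length R

sFuel-↭ : ∀ k xs → sFuel k xs ↭ xs
sFuel-↭ zero xs = ↭-refl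
sFuel-↭ (suc k) [] = ↭-refl
sFuel-↭ (suc k) (x ∷ xs) =
  ↭-trans (++⁺ (sFuel-↭ k L) (++⁺ (sFuel-↭ k R) ↭-refl))
    (↭-trans (++⁺ˡ L (↭-sym (∷↭∷ʳ m R)))
      (subst (L ++ m ∷ R ↭_) (splitAt-++-∷ m (x ∷ xs) (maxL-∈ x xs)) ↭-refl))
  where
  m = maxL (x ∷ xs)
  L = proj₁ (splitAt m (x ∷ xs))
  R = proj₂ (splitAt m (x ∷ xs))

stackSortIter-↭ : ∀ t xs → stackSortIter t xs ↭ xs
stackSortIter-↭ zero xs = ↭-refl
stackSortIter-↭ (suc t) xs = ↭-trans (stackSortIter-↭ t (stackSort xs)) (sFuel-↭ (length xs) xs)

AllPairs-∷ʳ⁻ : ∀ D d → AllPairs _<_ (D ∷ʳ d) → AllPairs _<_ D × All (_< d) D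
AllPairs-∷ʳ⁻ [] d _ = [] , []
AllPairs-∷ʳ⁻ (x ∷ D) d (x< ∷ D∷ʳd↑) =
  let (D↑ , D<d) = AllPairs-∷ʳ⁻ D d D∷ʳd↑
      (x<D , x<d) = AllP.∷ʳ⁻ x<
  in (x<D ∷ D↑) , (x<d ∷ D<d)

stackSort-increasing : ∀ {D} → Reverse D → AllPairs _<_ D → stackSort D ≡ D
stackSort-increasing [] _ = refl
stackSort-increasing (D ∶ D′ ∶ʳ d) D∷ʳd↑ =
  let (D↑ , D<d) = AllPairs-∷ʳ⁻ D d D∷ʳd↑
  in trans (stackSort-++-∷ D d [] D<d []) (cong (_++ [ d ]) (stackSort-increasing D′ D↑))

-- Avoiding 32‾41 means that every descent top is a left-to-right maximum

-- mx is the largest entry of the prefix preceding the list (0 initially).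
DescentTopsMaximal : ℕ → List ℕ → Set
DescentTopsMaximal mx [] = ⊤
DescentTopsMaximal mx (x ∷ []) = ⊤
DescentTopsMaximal mx (x ∷ y ∷ xs) = (y < x → mx ≤ x) × DescentTopsMaximal (mx ⊔ x) (y ∷ xs)

LookupDescentTopsMaximal : ℕ → List ℕ → Set
LookupDescentTopsMaximal mx xs = (i k : Fin (length xs)) → toℕ k ≡ suc (toℕ i) →
  lookup xs k < lookup xs i →
  mx ≤ lookup xs i × ((j : Fin (length xs)) → toℕ j < toℕ i → lookup xs j ≤ lookup xs i)

lookupDescentTopsMaximal-tail : ∀ mx x xs →
  LookupDescentTopsMaximal mx (x ∷ xs) → LookupDescentTopsMaximal (mx ⊔ x) xs
lookupDescentTopsMaximal-tail mx x xs h i k k≡1+i xₖ<xᵢ =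
  let (mx≤xᵢ , earlier≤xᵢ) = h (suc i) (suc k) (cong suc k≡1+i) xₖ<xᵢ
  in ⊔-lub mx≤xᵢ (earlier≤xᵢ zero (s≤s z≤n)) , λ j j<i → earlier≤xᵢ (suc j) (s≤s j<i)

lookup⇒descentTopsMaximal : ∀ mx xs → LookupDescentTopsMaximal mx xs → DescentTopsMaximal mx xs
lookup⇒descentTopsMaximal mx [] h = tt
lookup⇒descentTopsMaximal mx (x ∷ []) h = tt
lookup⇒descentTopsMaximal mx (x ∷ y ∷ xs) h =
  (λ y<x → proj₁ (h zero (suc zero) refl y<x)) ,
  lookup⇒descentTopsMaximal (mx ⊔ x) (y ∷ xs) (lookupDescentTopsMaximal-tail mx x (y ∷ xs) h)

descentTopsMaximal⇒lookup : ∀ mx xs → DescentTopsMaximal mx xs → LookupDescentTopsMaximal mx xs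
descentTopsMaximal⇒lookup mx (x ∷ []) _ zero zero ()
descentTopsMaximal⇒lookup mx (x ∷ y ∷ xs) _ zero zero ()
descentTopsMaximal⇒lookup mx (x ∷ y ∷ xs) (top , _) zero (suc zero) refl y<x = top y<x , λ _ ()
descentTopsMaximal⇒lookup mx (x ∷ y ∷ xs) _ zero (suc (suc k)) ()
descentTopsMaximal⇒lookup mx (x ∷ y ∷ xs) _ (suc i) zero ()
descentTopsMaximal⇒lookup mx (x ∷ y ∷ xs) (_ , rest) (suc i) (suc k) k≡1+i xₖ<xᵢ =
  ≤-trans (m≤m⊔n mx x) mx⊔x≤xᵢ , earlier≤xᵢ
  where
  ih = descentTopsMaximal⇒lookup (mx ⊔ x) (y ∷ xs) rest i k (suc-injective k≡1+i) xₖ<xᵢ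
  mx⊔x≤xᵢ = proj₁ ih
  earlier≤xᵢ : (j : Fin (length (x ∷ y ∷ xs))) → toℕ j < suc (toℕ i) →
    lookup (x ∷ y ∷ xs) j ≤ lookup (y ∷ xs) i
  earlier≤xᵢ zero _ = ≤-trans (m≤n⊔m mx x) mx⊔x≤xᵢ
  earlier≤xᵢ (suc j) (s≤s j<i) = proj₂ ih j j<i

avoids⇒lookupDescentTopsMaximal : ∀ xs → Avoids32b41 xs → LookupDescentTopsMaximal 0 xs
avoids⇒lookupDescentTopsMaximal xs av i k k≡1+i xₖ<xᵢ =
  z≤n , λ j j<i → ≮⇒≥ λ xᵢ<xⱼ → av (j , i , k , j<i , i<k , xᵢ<xⱼ , xₖ<xᵢ , nothingBetween)
  where
  i<k = ≤-reflexive (sym k≡1+i)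
  nothingBetween : ∀ {j} j′ → toℕ i < toℕ j′ → toℕ j′ < toℕ k → lookup xs j′ < lookup xs j
  nothingBetween j′ i<j′ j′<k = ⊥-elim (<⇒≱ j′<k (≤-trans (≤-reflexive k≡1+i) i<j′))

inversion⇒descent : ∀ (xs : List ℕ) (a b : Fin (length xs)) → toℕ a < toℕ b →
  lookup xs b < lookup xs a →
  ∃[ d ] ∃[ d′ ] (toℕ d′ ≡ suc (toℕ d) × toℕ a ≤ toℕ d × toℕ d < toℕ b × lookup xs d′ < lookup xs d)
inversion⇒descent (x ∷ xs) (suc a) (suc b) (s≤s a<b) xb<xa
  with d , d′ , d′≡1+d , a≤d , d<b , desc ← inversion⇒descent xs a b a<b xb<xa
  = suc d , suc d′ , cong suc d′≡1+d , s≤s a≤d , s≤s d<b , desc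
inversion⇒descent (x ∷ y ∷ xs) zero (suc b) _ xb<x with y <? x
... | yes y<x = zero , suc zero , refl , z≤n , s≤s z≤n , y<x
... | no y≮x with b
...   | zero = ⊥-elim (y≮x xb<x)
...   | suc b′ with d , d′ , d′≡1+d , _ , d<b , desc
                  ← inversion⇒descent (y ∷ xs) zero (suc b′) (s≤s z≤n) (<-≤-trans xb<x (≮⇒≥ y≮x))
  = suc d , suc d′ , cong suc d′≡1+d , z≤n , s≤s d<b , desc

lookupDescentTopsMaximal⇒avoids : ∀ xs → LookupDescentTopsMaximal 0 xs → Avoids32b41 xs
lookupDescentTopsMaximal⇒avoids xs h (i₁ , i₂ , i₃ , i₁<i₂ , i₂<i₃ , x₂<x₁ , x₃<x₂ , between<x₁)
  with d , d′ , d′≡1+d , i₂≤d , d<i₃ , desc ← inversion⇒descent xs i₂ i₃ i₂<i₃ x₃<x₂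
  with m≤n⇒m<n∨m≡n i₂≤d
... | inj₁ i₂<d =
  <⇒≱ (between<x₁ d i₂<d d<i₃) (proj₂ (h d d′ d′≡1+d desc) i₁ (<-trans i₁<i₂ i₂<d))
... | inj₂ i₂≡d =
  <⇒≱ (subst (λ z → lookup xs z < lookup xs i₁) (toℕ-injective i₂≡d) x₂<x₁)
      (proj₂ (h d d′ d′≡1+d desc) i₁ (subst (toℕ i₁ <_) i₂≡d i₁<i₂))

avoids⇒descentTopsMaximal : ∀ xs → Avoids32b41 xs → DescentTopsMaximal 0 xs
avoids⇒descentTopsMaximal xs av =
  lookup⇒descentTopsMaximal 0 xs (avoids⇒lookupDescentTopsMaximal xs av)

descentTopsMaximal⇒avoids : ∀ xs → DescentTopsMaximal 0 xs → Avoids32b41 xs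
descentTopsMaximal⇒avoids xs h =
  lookupDescentTopsMaximal⇒avoids xs (descentTopsMaximal⇒lookup 0 xs h)

-- Block decomposition

-- A block (m , C) stands for m followed by the run C; block lists are stored
-- last block first.
Block : Set
Block = ℕ × List ℕ

flat : List Block → List ℕ
flat [] = []
flat ((m , C) ∷ bs) = flat bs ++ m ∷ C

flatRotated : List Block → List ℕ
flatRotated [] = []
flatRotated ((m , C) ∷ bs) = flatRotated bs ++ C ++ [ m ]

ValidBlocks : List Block → Set
ValidBlocks [] = ⊤
ValidBlocks ((m , C) ∷ bs) =
  All (_< m) (flat bs) × All (_< m) C × AllPairs _<_ C × ValidBlocks bs

stackSort-flat : ∀ bs → ValidBlocks bs → stackSort (flat bs) ≡ flatRotated bs
stackSort-flat [] _ = refl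
stackSort-flat ((m , C) ∷ bs) (bs<m , C<m , C↑ , valid) =
  trans (stackSort-++-∷ (flat bs) m C bs<m C<m)
    (cong₂ _++_ (stackSort-flat bs valid) (cong (_++ [ m ]) (stackSort-increasing (reverseView C) C↑)))

foldl-⊔-< : ∀ {mx m} xs → mx ≤ m → All (_< m) xs → foldl _⊔_ mx xs ≤ m
foldl-⊔-< [] mx≤m _ = mx≤m
foldl-⊔-< (x ∷ xs) mx≤m (x<m ∷ xs<m) = foldl-⊔-< xs (⊔-lub mx≤m (<⇒≤ x<m)) xs<m

descentTopsMaximal-++-∷ : ∀ mx xs y ys → DescentTopsMaximal mx xs → All (_< y) xs →
  DescentTopsMaximal (foldl _⊔_ mx xs) (y ∷ ys) → DescentTopsMaximal mx (xs ++ y ∷ ys)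
descentTopsMaximal-++-∷ mx [] y ys _ _ h = h
descentTopsMaximal-++-∷ mx (x ∷ []) y ys _ (x<y ∷ []) h = (λ y<x → ⊥-elim (<-asym x<y y<x)) , h
descentTopsMaximal-++-∷ mx (x ∷ x′ ∷ xs) y ys (top , rest) (_ ∷ xs<y) h =
  top , descentTopsMaximal-++-∷ (mx ⊔ x) (x′ ∷ xs) y ys rest xs<y h

descentTopsMaximal-increasing : ∀ mx C → AllPairs _<_ C → DescentTopsMaximal mx C
descentTopsMaximal-increasing mx [] _ = tt
descentTopsMaximal-increasing mx (c ∷ []) _ = tt
descentTopsMaximal-increasing mx (c ∷ c′ ∷ C) ((c<c′ ∷ _) ∷ C↑) =
  (λ c′<c → ⊥-elim (<-asym c<c′ c′<c)) , descentTopsMaximal-increasing (mx ⊔ c) (c′ ∷ C) C↑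

descentTopsMaximal-block : ∀ {mx} m C → mx ≤ m → AllPairs _<_ C → DescentTopsMaximal mx (m ∷ C)
descentTopsMaximal-block m [] _ _ = tt
descentTopsMaximal-block {mx} m (c ∷ C) mx≤m C↑ =
  (λ _ → mx≤m) , descentTopsMaximal-increasing (mx ⊔ m) (c ∷ C) C↑

validBlocks⇒descentTopsMaximal : ∀ bs → ValidBlocks bs → DescentTopsMaximal 0 (flat bs)
validBlocks⇒descentTopsMaximal [] _ = tt
validBlocks⇒descentTopsMaximal ((m , C) ∷ bs) (bs<m , _ , C↑ , valid) =
  descentTopsMaximal-++-∷ 0 (flat bs) m C (validBlocks⇒descentTopsMaximal bs valid) bs<m
    (descentTopsMaximal-block m C (foldl-⊔-< (flat bs) z≤n bs<m) C↑)

validBlocks-open : ∀ {y} m C acc → m < y → ValidBlocks ((m , C) ∷ acc) →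
  ValidBlocks ((y , []) ∷ (m , C) ∷ acc)
validBlocks-open m C acc m<y valid@(acc<m , C<m , _) =
  AllP.++⁺ (All.map (λ z<m → <-trans z<m m<y) acc<m) (m<y ∷ All.map (λ z<m → <-trans z<m m<y) C<m) ,
  [] , [] , valid

validBlocks-∷ʳ : ∀ {y} m C acc → y < m → All (_< y) C → ValidBlocks ((m , C) ∷ acc) →
  ValidBlocks ((m , C ∷ʳ y) ∷ acc)
validBlocks-∷ʳ m C acc y<m C<y (acc<m , C<m , C↑ , valid) =
  acc<m , AllP.++⁺ C<m (y<m ∷ []) , AllPairsP.++⁺ C↑ ([] ∷ []) (All.map (_∷ []) C<y) , valid

flat-∷ʳ-++ : ∀ m C y acc rest → flat ((m , C ∷ʳ y) ∷ acc) ++ rest ≡ flat ((m , C) ∷ acc) ++ y ∷ rest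
flat-∷ʳ-++ m C y acc rest = begin
  (flat acc ++ m ∷ C ++ [ y ]) ++ rest   ≡⟨ ++-assoc (flat acc) (m ∷ C ++ [ y ]) rest ⟩
  flat acc ++ m ∷ (C ++ [ y ]) ++ rest   ≡⟨ cong (λ z → flat acc ++ m ∷ z) (++-assoc C [ y ] rest) ⟩
  flat acc ++ m ∷ C ++ y ∷ rest          ≡⟨ ++-assoc (flat acc) (m ∷ C) (y ∷ rest) ⟨
  (flat acc ++ m ∷ C) ++ y ∷ rest        ∎
  where open ≡-Reasoning

-- Scan the rest of the list with the current block (m , C) open; p is its
-- last entry and mx the largest entry before p.
decompose-from : ∀ (acc : List Block) (m p mx : ℕ) (C rest : List ℕ) →
  ValidBlocks ((m , C) ∷ acc) → All (_≤ p) C → (p ≡ m → C ≡ []) → m ≡ mx ⊔ p →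
  DescentTopsMaximal mx (p ∷ rest) → All (m ≢_) rest → All (p ≢_) rest → Unique rest →
  ∃[ bs ] (ValidBlocks bs × flat bs ≡ flat ((m , C) ∷ acc) ++ rest)
decompose-from acc m p mx C [] valid _ _ _ _ _ _ _ = _ , valid , sym (++-identityʳ _)
decompose-from acc m p mx C (y ∷ rest) valid C≤p p≡m⇒C≡[] m≡mx⊔p
  (top , rest-ok) (m≢y ∷ m≢rest) (p≢y ∷ _) (y≢rest ∷ rest-unique) with <-cmp y m
... | tri≈ _ y≡m _ = ⊥-elim (m≢y (sym y≡m))
... | tri> _ _ m<y =
  let (bs , valid-bs , flat≡) =
        decompose-from ((m , C) ∷ acc) y y (mx ⊔ p) [] rest (validBlocks-open m C acc m<y valid)
          [] (λ _ → refl) (sym (trans (cong (_⊔ y) (sym m≡mx⊔p)) (m≤n⇒m⊔n≡n (<⇒≤ m<y))))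
          rest-ok y≢rest y≢rest rest-unique
  in bs , valid-bs , trans flat≡ (++-assoc (flat ((m , C) ∷ acc)) [ y ] rest)
... | tri< y<m _ _ =
  let (bs , valid-bs , flat≡) =
        decompose-from acc m y (mx ⊔ p) (C ∷ʳ y) rest (validBlocks-∷ʳ m C acc y<m C<y valid)
          (AllP.++⁺ (All.map <⇒≤ C<y) (≤-refl ∷ [])) (λ y≡m → ⊥-elim (<-irrefl y≡m y<m))
          (sym (trans (cong (_⊔ y) (sym m≡mx⊔p)) (m≥n⇒m⊔n≡m (<⇒≤ y<m))))
          rest-ok m≢rest y≢rest rest-unique
  in bs , valid-bs , trans flat≡ (flat-∷ʳ-++ m C y acc rest)
  where
  -- If y < p then p is a descent top, so p = m and C is empty.
  C<y : All (_< y) C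
  C<y with <-cmp y p
  ... | tri< y<p _ _ = subst (All (_< y)) (sym (p≡m⇒C≡[] (sym (trans m≡mx⊔p (m≤n⇒m⊔n≡n (top y<p)))))) []
  ... | tri≈ _ y≡p _ = ⊥-elim (p≢y (sym y≡p))
  ... | tri> _ _ p<y = All.map (λ c≤p → ≤-<-trans c≤p p<y) C≤p

decompose : ∀ π → DescentTopsMaximal 0 π → Unique π → ∃[ bs ] (ValidBlocks bs × flat bs ≡ π)
decompose [] _ _ = [] , tt , refl
decompose (x ∷ rest) h (x≢rest ∷ rest-unique) =
  decompose-from [] x x 0 [] rest ([] , [] , [] , tt) [] (λ _ → refl) refl h x≢rest x≢rest rest-unique

-- Shifting the runs one block to the right

shift : List Block → List Block
shift [] = []
shift ((m , _) ∷ []) = (m , []) ∷ []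
shift ((m , _) ∷ (m′ , C′) ∷ bs) = (m , C′) ∷ shift ((m′ , C′) ∷ bs)

shift^ : ℕ → List Block → List Block
shift^ zero bs = bs
shift^ (suc j) bs = shift (shift^ j bs)

flatRotated-shift : ∀ m C bs → flatRotated (shift ((m , C) ∷ bs)) ≡ flat bs ++ [ m ]
flatRotated-shift m C [] = refl
flatRotated-shift m C ((m′ , C′) ∷ bs) = begin
  flatRotated (shift ((m′ , C′) ∷ bs)) ++ C′ ++ [ m ]  ≡⟨ cong (_++ C′ ++ [ m ]) (flatRotated-shift m′ C′ bs) ⟩
  (flat bs ++ [ m′ ]) ++ C′ ++ [ m ]                    ≡⟨ ++-assoc (flat bs) [ m′ ] (C′ ++ [ m ]) ⟩
  flat bs ++ m′ ∷ C′ ++ [ m ]                           ≡⟨ ++-assoc (flat bs) (m′ ∷ C′) [ m ] ⟨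
  (flat bs ++ m′ ∷ C′) ++ [ m ]                         ∎
  where open ≡-Reasoning

All-flat-shift : ∀ {P : ℕ → Set} bs → All P (flat bs) → All P (flat (shift bs))
All-flat-shift [] ps = ps
All-flat-shift ((m , C) ∷ []) ps = All.head (AllP.++⁻ʳ [] ps) ∷ []
All-flat-shift ((m , C) ∷ (m′ , C′) ∷ bs) ps =
  AllP.++⁺ (All-flat-shift ((m′ , C′) ∷ bs) front)
    (All.head back ∷ All.tail (AllP.++⁻ʳ (flat bs) front))
  where
  front = AllP.++⁻ˡ (flat bs ++ m′ ∷ C′) ps
  back = AllP.++⁻ʳ (flat bs ++ m′ ∷ C′) ps

validBlocks-shift : ∀ bs → ValidBlocks bs → ValidBlocks (shift bs)
validBlocks-shift [] _ = tt
validBlocks-shift ((m , C) ∷ []) _ = [] , [] , [] , tt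
validBlocks-shift ((m , C) ∷ (m′ , C′) ∷ bs) (bs<m , _ , _ , valid@(_ , C′<m′ , C′↑ , _)) =
  All-flat-shift ((m′ , C′) ∷ bs) bs<m ,
  All.map (λ x<m′ → <-trans x<m′ m′<m) C′<m′ ,
  C′↑ ,
  validBlocks-shift ((m′ , C′) ∷ bs) valid
  where
  m′<m : m′ < m
  m′<m = All.head (AllP.++⁻ʳ (flat bs) bs<m)

validBlocks-shift^ : ∀ j bs → ValidBlocks bs → ValidBlocks (shift^ j bs)
validBlocks-shift^ zero bs valid = valid
validBlocks-shift^ (suc j) bs valid = validBlocks-shift _ (validBlocks-shift^ j bs valid)

LastRunsEmpty : ℕ → List Block → Set
LastRunsEmpty zero bs = ⊤
LastRunsEmpty (suc ℓ) [] = ⊤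
LastRunsEmpty (suc ℓ) ((m , C) ∷ bs) = C ≡ [] × LastRunsEmpty ℓ bs

LastRunsEmpty-[] : ∀ ℓ → LastRunsEmpty ℓ []
LastRunsEmpty-[] zero = tt
LastRunsEmpty-[] (suc ℓ) = tt

LastRunsEmpty-suc : ∀ ℓ bs → LastRunsEmpty (suc ℓ) bs → LastRunsEmpty ℓ bs
LastRunsEmpty-suc zero bs _ = tt
LastRunsEmpty-suc (suc ℓ) [] _ = tt
LastRunsEmpty-suc (suc ℓ) ((m , C) ∷ bs) (C≡[] , empty) = C≡[] , LastRunsEmpty-suc ℓ bs empty

LastRunsEmpty-shift : ∀ ℓ bs → LastRunsEmpty (suc ℓ) bs → LastRunsEmpty ℓ (shift bs)
LastRunsEmpty-shift ℓ [] _ = LastRunsEmpty-[] ℓ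
LastRunsEmpty-shift zero (_ ∷ _) _ = tt
LastRunsEmpty-shift (suc ℓ) ((m , C) ∷ []) _ = refl , LastRunsEmpty-[] ℓ
LastRunsEmpty-shift (suc ℓ) ((m , C) ∷ (m′ , C′) ∷ bs) (_ , empty) =
  proj₁ empty , LastRunsEmpty-shift ℓ ((m′ , C′) ∷ bs) empty

LastRunsEmpty-shift^ : ∀ k j bs → LastRunsEmpty (k + j) bs → LastRunsEmpty k (shift^ j bs)
LastRunsEmpty-shift^ k zero bs empty rewrite +-identityʳ k = empty
LastRunsEmpty-shift^ k (suc j) bs empty rewrite +-suc k j =
  LastRunsEmpty-shift k (shift^ j bs) (LastRunsEmpty-shift^ (suc k) j bs empty)

stackSort-flat-shift : ∀ bs → ValidBlocks bs → LastRunsEmpty 1 bs → stackSort (flat (shift bs)) ≡ flat bs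
stackSort-flat-shift [] _ _ = refl
stackSort-flat-shift ((m , C) ∷ bs) valid (refl , _) =
  trans (stackSort-flat (shift ((m , []) ∷ bs)) (validBlocks-shift _ valid)) (flatRotated-shift m [] bs)

stackSortIter-flat-shift^ : ∀ ℓ bs → ValidBlocks bs → LastRunsEmpty ℓ bs →
  stackSortIter ℓ (flat (shift^ ℓ bs)) ≡ flat bs
stackSortIter-flat-shift^ zero bs _ _ = refl
stackSortIter-flat-shift^ (suc ℓ) bs valid empty =
  trans (cong (stackSortIter ℓ)
          (stackSort-flat-shift (shift^ ℓ bs) (validBlocks-shift^ ℓ bs valid) (LastRunsEmpty-shift^ 1 ℓ bs empty)))
    (stackSortIter-flat-shift^ ℓ bs valid (LastRunsEmpty-suc ℓ bs empty))

-- A fixed tail of length ℓ empties the last ℓ runs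

lookup-∷ʳ-last : ∀ {A : Set} (xs : List A) c →
  ∃[ p ] (toℕ {length (xs ∷ʳ c)} p ≡ length xs × lookup (xs ∷ʳ c) p ≡ c)
lookup-∷ʳ-last [] c = zero , refl , refl
lookup-∷ʳ-last (x ∷ xs) c with p , p≡ , xₚ≡c ← lookup-∷ʳ-last xs c = suc p , cong suc p≡ , xₚ≡c

lookup-∷ʳ-init : ∀ {A : Set} (xs : List A) c (p : Fin (length xs)) →
  ∃[ p′ ] (toℕ {length (xs ∷ʳ c)} p′ ≡ toℕ p × lookup (xs ∷ʳ c) p′ ≡ lookup xs p)
lookup-∷ʳ-init (x ∷ xs) c zero = zero , refl , refl
lookup-∷ʳ-init (x ∷ xs) c (suc p) with p′ , p′≡p , eq ← lookup-∷ʳ-init xs c p =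
  suc p′ , cong suc p′≡p , eq

length-∷ʳ : ∀ {A : Set} (xs : List A) (c : A) → length (xs ∷ʳ c) ≡ suc (length xs)
length-∷ʳ xs c = trans (length-++ xs) (+-comm (length xs) 1)

FixedSuffix-∷ʳ : ∀ {n ℓ} xs c → length (xs ∷ʳ c) ≡ n → FixedSuffix n (xs ∷ʳ c) (suc ℓ) →
  c ≡ n × FixedSuffix (length xs) xs ℓ
FixedSuffix-∷ʳ {ℓ = ℓ} xs c len≡n fixed with trans (sym (length-∷ʳ xs c)) len≡n
... | refl = last , init
  where
  last : c ≡ suc (length xs)
  last with p , p≡ , xₚ≡c ← lookup-∷ʳ-last xs c =
    trans (sym xₚ≡c) (trans (fixed p (subst (λ z → z + suc ℓ ≥ suc (length xs)) (sym p≡)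
      (subst (suc (length xs) ≤_) (sym (+-suc (length xs) ℓ)) (s≤s (m≤m+n _ _)))))
      (cong suc p≡))
  init : FixedSuffix (length xs) xs ℓ
  init p p+ℓ≥ with p′ , p′≡p , eq ← lookup-∷ʳ-init xs c p =
    trans (sym eq) (trans (fixed p′ (subst (λ z → z + suc ℓ ≥ suc (length xs)) (sym p′≡p)
      (subst (suc (length xs) ≤_) (sym (+-suc (toℕ p) ℓ)) (s≤s p+ℓ≥))))
      (cong suc p′≡p))

fixedSuffix⇒lastRunsEmpty : ∀ ℓ bs → ValidBlocks bs → All (_≤ length (flat bs)) (flat bs) →
  FixedSuffix (length (flat bs)) (flat bs) ℓ → LastRunsEmpty ℓ bs
fixedSuffix⇒lastRunsEmpty zero _ _ _ _ = tt
fixedSuffix⇒lastRunsEmpty (suc ℓ) [] _ _ _ = tt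
fixedSuffix⇒lastRunsEmpty (suc ℓ) ((m , C) ∷ bs) (bs<m , C<m , _ , valid) ≤n fixed
  with reverseView C
... | [] =
  let (m≡n , fixed′) = FixedSuffix-∷ʳ (flat bs) m refl fixed
      bs≤ = All.map (λ x<m → ≤-pred (subst (_ <_) (trans m≡n (length-∷ʳ (flat bs) m)) x<m)) bs<m
  in refl , fixedSuffix⇒lastRunsEmpty ℓ bs valid bs≤ fixed′
... | D ∶ _ ∶ʳ c = ⊥-elim (<-irrefl refl (<-≤-trans c<m m≤c))
  where
  reassoc : flat bs ++ m ∷ (D ∷ʳ c) ≡ (flat bs ++ m ∷ D) ∷ʳ c
  reassoc = sym (++-assoc (flat bs) (m ∷ D) [ c ])
  c<m : c < m
  c<m = All.head (AllP.++⁻ʳ D C<m)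
  c≡n : c ≡ length (flat bs ++ m ∷ (D ∷ʳ c))
  c≡n = proj₁ (FixedSuffix-∷ʳ (flat bs ++ m ∷ D) c (cong length (sym reassoc))
          (subst (λ z → FixedSuffix (length (flat bs ++ m ∷ (D ∷ʳ c))) z (suc ℓ)) reassoc fixed))
  m≤c : m ≤ c
  m≤c = subst (m ≤_) (sym c≡n) (All.head (AllP.++⁻ʳ (flat bs) ≤n))

IsPerm⇒Unique : ∀ {n π} → IsPerm n π → Unique π
IsPerm⇒Unique {n} π↭ =
  PermutationS.Unique-resp-↭ (setoid ℕ) (↭⇒↭ₛ (↭-sym π↭)) (UniqueP.map⁺ suc-injective (upTo⁺ n))

IsPerm⇒≤ : ∀ {n π} → IsPerm n π → All (_≤ n) π
IsPerm⇒≤ {n} π↭ = All.tabulate λ x∈π → bounded (∈-map⁻ suc (∈-resp-↭ π↭ x∈π))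
  where
  bounded : ∀ {x} → ∃[ y ] (y ∈ upTo n × x ≡ suc y) → x ≤ n
  bounded (y , y∈ , refl) = ∈-upTo⁻ y∈

IsPerm⇒length : ∀ {n π} → IsPerm n π → length π ≡ n
IsPerm⇒length {n} π↭ = trans (↭-length π↭) (trans (length-map suc (upTo n)) (length-upTo n))

proposition3p3 : (n : ℕ) (π : List ℕ) (ℓ : ℕ) → InAv n π → TailLength n π ℓ →
    ∃[ σ ] (InAv n σ × stackSortIter ℓ σ ≡ π)
proposition3p3 n π ℓ (π↭ , π-avoids) (_ , π-fixed , _)
  with bs , valid , refl ← decompose π (avoids⇒descentTopsMaximal π π-avoids) (IsPerm⇒Unique π↭)
  with refl ← IsPerm⇒length π↭
  = σ , (↭-trans (subst (σ ↭_) sσ≡π (↭-sym (stackSortIter-↭ ℓ σ))) π↭ , σ-avoids) , sσ≡π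
  where
  σ = flat (shift^ ℓ bs)
  sσ≡π : stackSortIter ℓ σ ≡ flat bs
  sσ≡π = stackSortIter-flat-shift^ ℓ bs valid
           (fixedSuffix⇒lastRunsEmpty ℓ bs valid (IsPerm⇒≤ π↭) π-fixed)
  σ-avoids : Avoids32b41 σ
  σ-avoids = descentTopsMaximal⇒avoids σ (validBlocks⇒descentTopsMaximal _ (validBlocks-shift^ ℓ bs valid))
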